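{- Let $n, r \geq 1$. Then: (i) $\mathcal{S}_{(r,n)}(x) = (x-1)\, \mathcal{S}_{(r,n-1)}(x) + \frac{r}{r+1}\, \mathcal{S}_{(r+1,n-1)}(x)$; (ii) $\mathcal{S}_{(r,n)}(x) = x^n - \frac{n}{r+1}\, \mathcal{S}_{(r+1,n-1)}(x)$; (iii) $\mathcal{S}_{(r+1,n)}(x) = \frac{r+1}{r+n+1} \left( x^{n+1} - (x-1)\, \mathcal{S}_{(r,n)}(x) \right)$; (iv) $\mathcal{S}_{(r,n+1)}(x) = \frac{r}{r+n+1} x^{n+1} + \frac{n+1}{r+n+1} (x-1)\, \mathcal{S}_{(r,n)}(x)$.
   Context: For integers $n, r \geq 0$, $\mathcal{S}_{(r,n)}(x) = \sum_{k=0}^{n} \binom{n}{k} (-1)^k x^{n-k} \binom{r+k}{r}^{ -1} \in \mathbb{Q}[x]$ (so $\mathcal{S}_{(r,0)}(x) = 1$). -}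

module Defs where

open import Data.Nat using (ℕ; zero; suc; _∸_)
import Data.Nat as ℕ
open import Data.Nat.Combinatorics using (_C_)
open import Data.Integer using (+_)
open import Data.Rational using (ℚ; 0ℚ; 1ℚ; _+_; _*_; -_; _/_)

_^_ : ℚ → ℕ → ℚ
x ^ zero  = 1ℚ
x ^ suc m = x * (x ^ m)

-- reciprocal of a natural number as a rational (only applied to binomial
-- coefficients (r+k) C r, which are ≥ 1; the value at 0 is irrelevant)
inv : ℕ → ℚ
inv zero    = 0ℚ
inv (suc m) = (+ 1) / suc m

sumTo : ℕ → (ℕ → ℚ) → ℚ
sumTo zero    f = f 0
sumTo (suc n) f = sumTo n f + f (suc n)

𝒮 : ℕ → ℕ → ℚ → ℚ
𝒮 r n x = sumTo n (λ k →
  ((+ (n C k)) / 1) * ((- 1ℚ) ^ k) * (x ^ (n ∸ k)) * inv ((r ℕ.+ k) C r))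

-- Splitting off the k = 0 term of 𝒮_(r,n+1) gives (ii) for every r ≥ 0, because absorption and
-- symmetry of binomial coefficients give
--   C(n+1,k+1) / C(r+k+1,r) = (n+1)/(r+1) · C(n,k) / C(r+k+1,r+1).
-- Using (ii) at ranks r and r+1, induction on n yields
--   (r+n+1) 𝒮_(r+1,n) = (r+1) (x^(n+1) − (x−1) 𝒮_(r,n)),
-- which is (iii) with the denominator cleared; (i) and (iv) are linear combinations of (ii) and (iii).
module Submission where

open import Data.Nat as ℕ using (ℕ; zero; suc; _∸_; _≤_; z≤n; s≤s)
import Data.Nat.Properties as ℕ
open import Data.Nat.Combinatorics
  using (_C_; nCn≡1; nC1≡n; nCk+nC[k+1]≡[n+1]C[k+1]; nCk≡nC[n∸k])
open import Data.Integer as ℤ using (+_)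
import Data.Integer.Properties as ℤ
open import Data.Rational using (ℚ; 0ℚ; 1ℚ; _+_; _*_; _-_; -_; _/_; toℚᵘ)
open import Data.Rational.Properties
  using (+-*-commutativeRing; _≟_; toℚᵘ-injective; toℚᵘ-fromℚᵘ; toℚᵘ-homo-+; toℚᵘ-homo-*;
         +-assoc; *-assoc; *-comm; *-distribˡ-+; *-identityˡ; *-identityʳ; neg-distribˡ-*)
open import Data.Rational.Unnormalised as ℚᵘ using (mkℚᵘ; *≡*)
import Data.Rational.Unnormalised.Properties as ℚᵘ
open import Data.List using (_∷_; [])
open import Level using (0ℓ)
open import Relation.Nullary.Decidable using (dec⇒maybe)
open import Tactic.RingSolver.Core.AlmostCommutativeRing
  using (AlmostCommutativeRing; fromCommutativeRing)
open import Tactic.RingSolver using (solve)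
open import Data.Product using (_×_; _,_)
open import Function using (_∘_)
open import Relation.Binary.PropositionalEquality
open import Defs

ℚ-ring : AlmostCommutativeRing 0ℓ 0ℓ
ℚ-ring = fromCommutativeRing +-*-commutativeRing (λ q → dec⇒maybe (0ℚ ≟ q))

fromℕ : ℕ → ℚ
fromℕ n = + n / 1

private
  toℚᵘ-/ : ∀ n d → toℚᵘ (+ n / suc d) ℚᵘ.≃ mkℚᵘ (+ n) d
  toℚᵘ-/ n d = toℚᵘ-fromℚᵘ (mkℚᵘ (+ n) d)

fromℕ-+ : ∀ m n → fromℕ (m ℕ.+ n) ≡ fromℕ m + fromℕ n
fromℕ-+ m n = toℚᵘ-injective (begin
  toℚᵘ (fromℕ (m ℕ.+ n))
    ≈⟨ toℚᵘ-/ (m ℕ.+ n) 0 ⟩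
  mkℚᵘ (+ (m ℕ.+ n)) 0
    ≈⟨ *≡* (cong (ℤ._* + 1) (cong₂ ℤ._+_ (sym (ℤ.*-identityʳ (+ m))) (sym (ℤ.*-identityʳ (+ n))))) ⟩
  mkℚᵘ (+ m) 0 ℚᵘ.+ mkℚᵘ (+ n) 0
    ≈⟨ ℚᵘ.+-cong (toℚᵘ-/ m 0) (toℚᵘ-/ n 0) ⟨
  toℚᵘ (fromℕ m) ℚᵘ.+ toℚᵘ (fromℕ n)
    ≈⟨ toℚᵘ-homo-+ (fromℕ m) (fromℕ n) ⟨
  toℚᵘ (fromℕ m + fromℕ n) ∎)
  where open ℚᵘ.≃-Reasoning

fromℕ-* : ∀ m n → fromℕ (m ℕ.* n) ≡ fromℕ m * fromℕ n
fromℕ-* m n = toℚᵘ-injective (begin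
  toℚᵘ (fromℕ (m ℕ.* n))
    ≈⟨ toℚᵘ-/ (m ℕ.* n) 0 ⟩
  mkℚᵘ (+ (m ℕ.* n)) 0
    ≈⟨ *≡* (cong (ℤ._* + 1) (ℤ.pos-* m n)) ⟩
  mkℚᵘ (+ m) 0 ℚᵘ.* mkℚᵘ (+ n) 0
    ≈⟨ ℚᵘ.*-cong (toℚᵘ-/ m 0) (toℚᵘ-/ n 0) ⟨
  toℚᵘ (fromℕ m) ℚᵘ.* toℚᵘ (fromℕ n)
    ≈⟨ toℚᵘ-homo-* (fromℕ m) (fromℕ n) ⟨
  toℚᵘ (fromℕ m * fromℕ n) ∎)
  where open ℚᵘ.≃-Reasoning

+m/[1+n]≡m*inv[1+n] : ∀ m n → + m / suc n ≡ fromℕ m * inv (suc n)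
+m/[1+n]≡m*inv[1+n] m n = toℚᵘ-injective (begin
  toℚᵘ (+ m / suc n)
    ≈⟨ toℚᵘ-/ m n ⟩
  mkℚᵘ (+ m) n
    ≈⟨ *≡* (cong₂ ℤ._*_ (sym (ℤ.*-identityʳ (+ m))) (cong +_ (ℕ.*-identityˡ (suc n)))) ⟩
  mkℚᵘ (+ m) 0 ℚᵘ.* mkℚᵘ (+ 1) n
    ≈⟨ ℚᵘ.*-cong (toℚᵘ-/ m 0) (toℚᵘ-/ 1 n) ⟨
  toℚᵘ (fromℕ m) ℚᵘ.* toℚᵘ (inv (suc n))
    ≈⟨ toℚᵘ-homo-* (fromℕ m) (inv (suc n)) ⟨
  toℚᵘ (fromℕ m * inv (suc n)) ∎)
  where open ℚᵘ.≃-Reasoning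

inv-inverseˡ : ∀ n → 0 ℕ.< n → inv n * fromℕ n ≡ 1ℚ
inv-inverseˡ (suc n) _ = toℚᵘ-injective (begin
  toℚᵘ (inv (suc n) * fromℕ (suc n))
    ≈⟨ toℚᵘ-homo-* (inv (suc n)) (fromℕ (suc n)) ⟩
  toℚᵘ (inv (suc n)) ℚᵘ.* toℚᵘ (fromℕ (suc n))
    ≈⟨ ℚᵘ.*-cong (toℚᵘ-/ 1 n) (toℚᵘ-/ (suc n) 0) ⟩
  mkℚᵘ (+ 1) n ℚᵘ.* mkℚᵘ (+ suc n) 0
    ≈⟨ *≡* (trans (ℤ.*-identityʳ (+ 1 ℤ.* + suc n))
                  (cong (λ d → + 1 ℤ.* + d) (sym (ℕ.*-identityʳ (suc n))))) ⟩
  ℚᵘ.1ℚᵘ ∎)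
  where open ℚᵘ.≃-Reasoning

fromℕ-[1+m+n] : ∀ m n → fromℕ (suc (m ℕ.+ n)) ≡ fromℕ m + fromℕ (suc n)
fromℕ-[1+m+n] m n = trans (cong fromℕ (sym (ℕ.+-suc m n))) (fromℕ-+ m (suc n))

open ≡-Reasoning

cross-multiply : ∀ {a b d e m r d⁻ e⁻ r⁻ : ℚ} →
                 d⁻ * d ≡ 1ℚ → r⁻ * r ≡ 1ℚ → e⁻ * e ≡ 1ℚ →
                 a * (r * e) ≡ (m * b) * d → a * d⁻ ≡ (m * r⁻) * (b * e⁻)
cross-multiply {a} {b} {d} {e} {m} {r} {d⁻} {e⁻} {r⁻} d⁻d≡1 r⁻r≡1 e⁻e≡1 are≡mbd = begin
  a * d⁻                                ≡⟨ solve (a ∷ d⁻ ∷ []) ℚ-ring ⟩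
  a * d⁻ * 1ℚ * 1ℚ                      ≡⟨ cong₂ (λ u v → a * d⁻ * u * v) r⁻r≡1 e⁻e≡1 ⟨
  a * d⁻ * (r⁻ * r) * (e⁻ * e)          ≡⟨ solve (a ∷ d⁻ ∷ r⁻ ∷ r ∷ e⁻ ∷ e ∷ []) ℚ-ring ⟩
  r⁻ * e⁻ * d⁻ * (a * (r * e))          ≡⟨ cong (r⁻ * e⁻ * d⁻ *_) are≡mbd ⟩
  r⁻ * e⁻ * d⁻ * ((m * b) * d)          ≡⟨ solve (r⁻ ∷ e⁻ ∷ d⁻ ∷ m ∷ b ∷ d ∷ []) ℚ-ring ⟩
  (m * r⁻) * (b * e⁻) * (d⁻ * d)        ≡⟨ cong ((m * r⁻) * (b * e⁻) *_) d⁻d≡1 ⟩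
  (m * r⁻) * (b * e⁻) * 1ℚ              ≡⟨ *-identityʳ ((m * r⁻) * (b * e⁻)) ⟩
  (m * r⁻) * (b * e⁻)                   ∎

inverseˡ-transpose : ∀ a a⁻ s {t} → a⁻ * a ≡ 1ℚ → a * s ≡ t → s ≡ a⁻ * t
inverseˡ-transpose a a⁻ s a⁻a≡1 refl = begin
  s              ≡⟨ *-identityˡ s ⟨
  1ℚ * s         ≡⟨ cong (_* s) a⁻a≡1 ⟨
  (a⁻ * a) * s   ≡⟨ *-assoc a⁻ a s ⟩
  a⁻ * (a * s)   ∎

k≤n⇒nCk>0 : ∀ {n k} → k ≤ n → 0 ℕ.< n C k
k≤n⇒nCk>0 {n} {zero} _ = s≤s z≤n
k≤n⇒nCk>0 {suc n} {suc k} (s≤s k≤n) =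
  subst (0 ℕ.<_) (nCk+nC[k+1]≡[n+1]C[k+1] n k)
    (ℕ.<-≤-trans (k≤n⇒nCk>0 k≤n) (ℕ.m≤m+n (n C k) (n C suc k)))

[k+1]*[n+1]C[k+1]≡[n+1]*nCk : ∀ n k → suc k ℕ.* (suc n C suc k) ≡ suc n ℕ.* (n C k)
[k+1]*[n+1]C[k+1]≡[n+1]*nCk zero    zero    = refl
[k+1]*[n+1]C[k+1]≡[n+1]*nCk zero    (suc k) = ℕ.*-zeroʳ (suc (suc k))
[k+1]*[n+1]C[k+1]≡[n+1]*nCk (suc n) zero    = begin
  1 ℕ.* (suc (suc n) C 1) ≡⟨ ℕ.*-identityˡ (suc (suc n) C 1) ⟩
  suc (suc n) C 1         ≡⟨ nC1≡n (suc (suc n)) ⟩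
  suc (suc n)             ≡⟨ ℕ.*-identityʳ (suc (suc n)) ⟨
  suc (suc n) ℕ.* 1       ∎
[k+1]*[n+1]C[k+1]≡[n+1]*nCk (suc n) (suc k) = begin
  suc (suc k) ℕ.* (suc N C suc (suc k))
    ≡⟨ cong (suc (suc k) ℕ.*_) (nCk+nC[k+1]≡[n+1]C[k+1] N (suc k)) ⟨
  suc (suc k) ℕ.* (N C suc k ℕ.+ N C suc (suc k))
    ≡⟨ trans (ℕ.*-distribˡ-+ (suc (suc k)) a b) (ℕ.+-assoc a (suc k ℕ.* a) (suc (suc k) ℕ.* b)) ⟩
  N C suc k ℕ.+ (suc k ℕ.* (N C suc k) ℕ.+ suc (suc k) ℕ.* (N C suc (suc k)))
    ≡⟨ cong₂ (λ u v → N C suc k ℕ.+ (u ℕ.+ v))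
         ([k+1]*[n+1]C[k+1]≡[n+1]*nCk n k) ([k+1]*[n+1]C[k+1]≡[n+1]*nCk n (suc k)) ⟩
  N C suc k ℕ.+ (N ℕ.* (n C k) ℕ.+ N ℕ.* (n C suc k))
    ≡⟨ cong (N C suc k ℕ.+_) (ℕ.*-distribˡ-+ N (n C k) (n C suc k)) ⟨
  N C suc k ℕ.+ N ℕ.* (n C k ℕ.+ n C suc k)
    ≡⟨ cong (λ u → N C suc k ℕ.+ N ℕ.* u) (nCk+nC[k+1]≡[n+1]C[k+1] n k) ⟩
  suc N ℕ.* (N C suc k) ∎
  where
  N = suc n
  a = N C suc k
  b = N C suc (suc k)

[m+n]Cm≡[m+n]Cn : ∀ m n → (m ℕ.+ n) C m ≡ (m ℕ.+ n) C n
[m+n]Cm≡[m+n]Cn m n = begin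
  (m ℕ.+ n) C m              ≡⟨ nCk≡nC[n∸k] (ℕ.m≤m+n m n) ⟩
  (m ℕ.+ n) C (m ℕ.+ n ∸ m)  ≡⟨ cong ((m ℕ.+ n) C_) (ℕ.m+n∸m≡n m n) ⟩
  (m ℕ.+ n) C n              ∎

[m+1]*[m+n+1]C[m+1]≡[n+1]*[m+n+1]Cm :
  ∀ m n → suc m ℕ.* (suc (m ℕ.+ n) C suc m) ≡ suc n ℕ.* (suc (m ℕ.+ n) C m)
[m+1]*[m+n+1]C[m+1]≡[n+1]*[m+n+1]Cm m n = begin
  suc m ℕ.* (suc (m ℕ.+ n) C suc m)  ≡⟨ [k+1]*[n+1]C[k+1]≡[n+1]*nCk (m ℕ.+ n) m ⟩
  suc (m ℕ.+ n) ℕ.* ((m ℕ.+ n) C m)  ≡⟨ cong (suc (m ℕ.+ n) ℕ.*_) ([m+n]Cm≡[m+n]Cn m n) ⟩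
  suc (m ℕ.+ n) ℕ.* ((m ℕ.+ n) C n)  ≡⟨ [k+1]*[n+1]C[k+1]≡[n+1]*nCk (m ℕ.+ n) n ⟨
  suc n ℕ.* (suc (m ℕ.+ n) C suc n)  ≡⟨ cong (λ t → suc n ℕ.* (t C suc n)) (ℕ.+-suc m n) ⟨
  suc n ℕ.* ((m ℕ.+ suc n) C suc n)  ≡⟨ cong (suc n ℕ.*_) ([m+n]Cm≡[m+n]Cn m (suc n)) ⟨
  suc n ℕ.* ((m ℕ.+ suc n) C m)      ≡⟨ cong (λ t → suc n ℕ.* (t C m)) (ℕ.+-suc m n) ⟩
  suc n ℕ.* (suc (m ℕ.+ n) C m)      ∎

sumTo-cong : ∀ n {f g : ℕ → ℚ} → (∀ k → f k ≡ g k) → sumTo n f ≡ sumTo n g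
sumTo-cong zero    f≗g = f≗g 0
sumTo-cong (suc n) f≗g = cong₂ _+_ (sumTo-cong n f≗g) (f≗g (suc n))

*-distribˡ-sumTo : ∀ n a f → sumTo n (λ k → a * f k) ≡ a * sumTo n f
*-distribˡ-sumTo zero    a f = refl
*-distribˡ-sumTo (suc n) a f =
  trans (cong (_+ a * f (suc n)) (*-distribˡ-sumTo n a f))
        (sym (*-distribˡ-+ a (sumTo n f) (f (suc n))))

sumTo-suc : ∀ n f → sumTo (suc n) f ≡ f 0 + sumTo n (λ k → f (suc k))
sumTo-suc zero    f = refl
sumTo-suc (suc n) f =
  trans (cong (_+ f (suc (suc n))) (sumTo-suc n f)) (+-assoc (f 0) _ (f (suc (suc n))))

-- 𝒮 r n x unfolds definitionally to sumTo n (term r n x).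
term : ℕ → ℕ → ℚ → ℕ → ℚ
term r n x k = fromℕ (n C k) * (- 1ℚ) ^ k * x ^ (n ∸ k) * inv ((r ℕ.+ k) C r)

term-zero : ∀ r n x → term r n x 0 ≡ x ^ n
term-zero r n x = begin
  1ℚ * 1ℚ * x ^ n * inv ((r ℕ.+ 0) C r)  ≡⟨ cong (λ c → 1ℚ * x ^ n * inv c) r+0Cr≡1 ⟩
  1ℚ * x ^ n * 1ℚ                        ≡⟨ *-identityʳ (1ℚ * x ^ n) ⟩
  1ℚ * x ^ n                             ≡⟨ *-identityˡ (x ^ n) ⟩
  x ^ n                                  ∎
  where r+0Cr≡1 = trans (cong (_C r) (ℕ.+-identityʳ r)) (nCn≡1 r)

𝒮-zero : ∀ r x → 𝒮 r 0 x ≡ 1ℚ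
𝒮-zero r = term-zero r 0

binomial-ratio : ∀ m k r →
  fromℕ (suc m C suc k) * inv (suc (r ℕ.+ k) C r)
    ≡ (fromℕ (suc m) * inv (suc r)) * (fromℕ (m C k) * inv (suc (r ℕ.+ k) C suc r))
binomial-ratio m k r = cross-multiply {a = fromℕ A} {b = fromℕ B} {m = fromℕ (suc m)}
  (inv-inverseˡ D (k≤n⇒nCk>0 (ℕ.m≤n⇒m≤1+n (ℕ.m≤m+n r k))))
  (inv-inverseˡ (suc r) (s≤s z≤n))
  (inv-inverseˡ E (k≤n⇒nCk>0 (s≤s (ℕ.m≤m+n r k))))
  (begin
    fromℕ A * (fromℕ (suc r) * fromℕ E)   ≡⟨ cong (fromℕ A *_) (fromℕ-* (suc r) E) ⟨
    fromℕ A * fromℕ (suc r ℕ.* E)         ≡⟨ fromℕ-* A (suc r ℕ.* E) ⟨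
    fromℕ (A ℕ.* (suc r ℕ.* E))           ≡⟨ cong fromℕ cross-ℕ ⟩
    fromℕ (suc m ℕ.* B ℕ.* D)             ≡⟨ fromℕ-* (suc m ℕ.* B) D ⟩
    fromℕ (suc m ℕ.* B) * fromℕ D         ≡⟨ cong (_* fromℕ D) (fromℕ-* (suc m) B) ⟩
    fromℕ (suc m) * fromℕ B * fromℕ D     ∎)
  where
  A = suc m C suc k
  B = m C k
  D = suc (r ℕ.+ k) C r
  E = suc (r ℕ.+ k) C suc r
  cross-ℕ : A ℕ.* (suc r ℕ.* E) ≡ suc m ℕ.* B ℕ.* D
  cross-ℕ = begin
    A ℕ.* (suc r ℕ.* E)   ≡⟨ cong (A ℕ.*_) ([m+1]*[m+n+1]C[m+1]≡[n+1]*[m+n+1]Cm r k) ⟩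
    A ℕ.* (suc k ℕ.* D)   ≡⟨ ℕ.*-assoc A (suc k) D ⟨
    A ℕ.* suc k ℕ.* D     ≡⟨ cong (ℕ._* D) (ℕ.*-comm A (suc k)) ⟩
    suc k ℕ.* A ℕ.* D     ≡⟨ cong (ℕ._* D) ([k+1]*[n+1]C[k+1]≡[n+1]*nCk m k) ⟩
    suc m ℕ.* B ℕ.* D     ∎

term-suc : ∀ r m x k →
  term r (suc m) x (suc k) ≡ - (fromℕ (suc m) * inv (suc r)) * term (suc r) m x k
term-suc r m x k = begin
  fromℕ (suc m C suc k) * ((- 1ℚ) * (- 1ℚ) ^ k) * x ^ (m ∸ k) * inv ((r ℕ.+ suc k) C r)
    ≡⟨ cong (λ n → fromℕ (suc m C suc k) * ((- 1ℚ) * (- 1ℚ) ^ k) * x ^ (m ∸ k) * inv (n C r))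
            (ℕ.+-suc r k) ⟩
  fromℕ (suc m C suc k) * ((- 1ℚ) * (- 1ℚ) ^ k) * x ^ (m ∸ k) * inv (suc (r ℕ.+ k) C r)
    ≡⟨ regroup {a = fromℕ (suc m C suc k)} {c = fromℕ (suc m) * inv (suc r)} {b = fromℕ (m C k)}
               (binomial-ratio m k r) ⟩
  - (fromℕ (suc m) * inv (suc r)) * term (suc r) m x k ∎
  where
  regroup : ∀ {a d c b e s y} → a * d ≡ c * (b * e) →
            a * ((- 1ℚ) * s) * y * d ≡ - c * (b * s * y * e)
  regroup {a} {d} {c} {b} {e} {s} {y} ad≡cbe = begin
    a * ((- 1ℚ) * s) * y * d   ≡⟨ solve (a ∷ s ∷ y ∷ d ∷ []) ℚ-ring ⟩
    - (a * d) * (s * y)        ≡⟨ cong (λ q → - q * (s * y)) ad≡cbe ⟩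
    - (c * (b * e)) * (s * y)  ≡⟨ solve (c ∷ b ∷ e ∷ s ∷ y ∷ []) ℚ-ring ⟩
    - c * (b * s * y * e)      ∎

𝒮-suc-degree : ∀ r m x →
  𝒮 r (suc m) x ≡ x ^ suc m - (fromℕ (suc m) * inv (suc r)) * 𝒮 (suc r) m x
𝒮-suc-degree r m x = begin
  𝒮 r (suc m) x
    ≡⟨ sumTo-suc m (term r (suc m) x) ⟩
  term r (suc m) x 0 + sumTo m (λ k → term r (suc m) x (suc k))
    ≡⟨ cong₂ _+_ (term-zero r (suc m) x) (sumTo-cong m (term-suc r m x)) ⟩
  x ^ suc m + sumTo m (λ k → - c * term (suc r) m x k)
    ≡⟨ cong (_+_ (x ^ suc m)) (*-distribˡ-sumTo m (- c) (term (suc r) m x)) ⟩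
  x ^ suc m + - c * 𝒮 (suc r) m x
    ≡⟨ cong (_+_ (x ^ suc m)) (neg-distribˡ-* c (𝒮 (suc r) m x)) ⟨
  x ^ suc m - c * 𝒮 (suc r) m x ∎
  where c = fromℕ (suc m) * inv (suc r)

𝒮-suc-rank-scaled : ∀ r n x →
  fromℕ (suc (r ℕ.+ n)) * 𝒮 (suc r) n x ≡ fromℕ (suc r) * (x ^ suc n - (x - 1ℚ) * 𝒮 r n x)
𝒮-suc-rank-scaled r zero x = begin
  fromℕ (suc (r ℕ.+ 0)) * 𝒮 (suc r) 0 x
    ≡⟨ cong₂ _*_ (cong (fromℕ ∘ suc) (ℕ.+-identityʳ r)) (𝒮-zero (suc r) x) ⟩
  fromℕ (suc r) * 1ℚ
    ≡⟨ cong (fromℕ (suc r) *_) (solve (x ∷ []) ℚ-ring) ⟩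
  fromℕ (suc r) * (x * 1ℚ - (x - 1ℚ) * 1ℚ)
    ≡⟨ cong (λ s → fromℕ (suc r) * (x * 1ℚ - (x - 1ℚ) * s)) (𝒮-zero r x) ⟨
  fromℕ (suc r) * (x ^ 1 - (x - 1ℚ) * 𝒮 r 0 x) ∎
𝒮-suc-rank-scaled r (suc m) x = begin
  fromℕ (suc (r ℕ.+ suc m)) * 𝒮 (suc r) (suc m) x
    ≡⟨ cong (fromℕ (suc (r ℕ.+ suc m)) *_) (𝒮-suc-degree (suc r) m x) ⟩
  fromℕ (suc (r ℕ.+ suc m)) * (x ^ suc m - (fromℕ (suc m) * inv (suc (suc r))) * 𝒮 (suc (suc r)) m x)
    ≡⟨ rank-step (fromℕ (suc r)) (fromℕ (suc (suc r))) (fromℕ (suc m)) (inv (suc r)) (inv (suc (suc r)))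
                 (x ^ suc m) x (𝒮 (suc (suc r)) m x) (𝒮 (suc r) m x)
                 (fromℕ-+ (suc r) (suc m)) (inv-inverseˡ (suc r) (s≤s z≤n))
                 (inv-inverseˡ (suc (suc r)) (s≤s z≤n)) IH ⟩
  fromℕ (suc r) * (x * x ^ suc m - (x - 1ℚ) * (x ^ suc m - (fromℕ (suc m) * inv (suc r)) * 𝒮 (suc r) m x))
    ≡⟨ cong (λ s → fromℕ (suc r) * (x ^ suc (suc m) - (x - 1ℚ) * s)) (𝒮-suc-degree r m x) ⟨
  fromℕ (suc r) * (x ^ suc (suc m) - (x - 1ℚ) * 𝒮 r (suc m) x) ∎
  where
  IH : fromℕ (suc (r ℕ.+ suc m)) * 𝒮 (suc (suc r)) m x
         ≡ fromℕ (suc (suc r)) * (x ^ suc m - (x - 1ℚ) * 𝒮 (suc r) m x)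
  IH = trans (cong (λ n → fromℕ (suc n) * 𝒮 (suc (suc r)) m x) (ℕ.+-suc r m))
             (𝒮-suc-rank-scaled (suc r) m x)
  rank-step : ∀ R R₂ M r⁻ r₂⁻ X x T U {K} → K ≡ R + M → r⁻ * R ≡ 1ℚ → r₂⁻ * R₂ ≡ 1ℚ →
              K * T ≡ R₂ * (X - (x - 1ℚ) * U) →
              K * (X - (M * r₂⁻) * T) ≡ R * (x * X - (x - 1ℚ) * (X - (M * r⁻) * U))
  rank-step R R₂ M r⁻ r₂⁻ X x T U refl r⁻R≡1 r₂⁻R₂≡1 KT≡R₂Y = begin
    (R + M) * (X - (M * r₂⁻) * T)
      ≡⟨ solve (R ∷ M ∷ X ∷ r₂⁻ ∷ T ∷ []) ℚ-ring ⟩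
    R * X + M * X - M * r₂⁻ * ((R + M) * T)
      ≡⟨ cong (λ q → R * X + M * X - M * r₂⁻ * q) KT≡R₂Y ⟩
    R * X + M * X - M * r₂⁻ * (R₂ * (X - (x - 1ℚ) * U))
      ≡⟨ solve (R ∷ M ∷ X ∷ r₂⁻ ∷ R₂ ∷ x ∷ U ∷ []) ℚ-ring ⟩
    R * X + M * X - M * (r₂⁻ * R₂) * (X - (x - 1ℚ) * U)
      ≡⟨ cong (λ q → R * X + M * X - M * q * (X - (x - 1ℚ) * U)) r₂⁻R₂≡1 ⟩
    R * X + M * X - M * 1ℚ * (X - (x - 1ℚ) * U)
      ≡⟨ solve (R ∷ M ∷ X ∷ x ∷ U ∷ []) ℚ-ring ⟩
    R * X + M * 1ℚ * (x - 1ℚ) * U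
      ≡⟨ cong (λ q → R * X + M * q * (x - 1ℚ) * U) r⁻R≡1 ⟨
    R * X + M * (r⁻ * R) * (x - 1ℚ) * U
      ≡⟨ solve (R ∷ M ∷ X ∷ r⁻ ∷ x ∷ U ∷ []) ℚ-ring ⟩
    R * (x * X - (x - 1ℚ) * (X - (M * r⁻) * U)) ∎

𝒮-suc-degree-three-term : ∀ r m x →
  𝒮 r (suc m) x ≡ (x - 1ℚ) * 𝒮 r m x + (fromℕ r * inv (suc r)) * 𝒮 (suc r) m x
𝒮-suc-degree-three-term r m x = begin
  𝒮 r (suc m) x
    ≡⟨ 𝒮-suc-degree r m x ⟩
  x ^ suc m - (fromℕ (suc m) * inv (suc r)) * 𝒮 (suc r) m x
    ≡⟨ three-term (fromℕ r) (fromℕ (suc r)) (fromℕ (suc m)) (inv (suc r))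
                  (x ^ suc m) x (𝒮 r m x) (𝒮 (suc r) m x)
                  (fromℕ-[1+m+n] r m) (inv-inverseˡ (suc r) (s≤s z≤n)) (𝒮-suc-rank-scaled r m x) ⟩
  (x - 1ℚ) * 𝒮 r m x + (fromℕ r * inv (suc r)) * 𝒮 (suc r) m x ∎
  where
  three-term : ∀ ρ R M r⁻ X x S S′ {K} → K ≡ ρ + M → r⁻ * R ≡ 1ℚ →
               K * S′ ≡ R * (X - (x - 1ℚ) * S) →
               X - (M * r⁻) * S′ ≡ (x - 1ℚ) * S + (ρ * r⁻) * S′
  three-term ρ R M r⁻ X x S S′ refl r⁻R≡1 KS′≡RY = begin
    X - (M * r⁻) * S′
      ≡⟨ solve (ρ ∷ M ∷ r⁻ ∷ X ∷ x ∷ S ∷ S′ ∷ []) ℚ-ring ⟩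
    (x - 1ℚ) * S + (ρ * r⁻) * S′ + ((X - (x - 1ℚ) * S) - r⁻ * ((ρ + M) * S′))
      ≡⟨ cong (λ q → (x - 1ℚ) * S + (ρ * r⁻) * S′ + ((X - (x - 1ℚ) * S) - r⁻ * q)) KS′≡RY ⟩
    (x - 1ℚ) * S + (ρ * r⁻) * S′ + ((X - (x - 1ℚ) * S) - r⁻ * (R * (X - (x - 1ℚ) * S)))
      ≡⟨ solve (ρ ∷ R ∷ r⁻ ∷ X ∷ x ∷ S ∷ S′ ∷ []) ℚ-ring ⟩
    (x - 1ℚ) * S + (ρ * r⁻) * S′ + (1ℚ - r⁻ * R) * (X - (x - 1ℚ) * S)
      ≡⟨ cong (λ q → (x - 1ℚ) * S + (ρ * r⁻) * S′ + (1ℚ - q) * (X - (x - 1ℚ) * S)) r⁻R≡1 ⟩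
    (x - 1ℚ) * S + (ρ * r⁻) * S′ + (1ℚ - 1ℚ) * (X - (x - 1ℚ) * S)
      ≡⟨ solve (ρ ∷ r⁻ ∷ X ∷ x ∷ S ∷ S′ ∷ []) ℚ-ring ⟩
    (x - 1ℚ) * S + (ρ * r⁻) * S′ ∎

𝒮-suc-rank : ∀ r n x →
  𝒮 (suc r) n x ≡ (fromℕ (suc r) * inv (suc (r ℕ.+ n))) * (x ^ suc n - (x - 1ℚ) * 𝒮 r n x)
𝒮-suc-rank r n x = begin
  𝒮 (suc r) n x
    ≡⟨ inverseˡ-transpose (fromℕ K) (inv K) (𝒮 (suc r) n x)
                          (inv-inverseˡ K (s≤s z≤n)) (𝒮-suc-rank-scaled r n x) ⟩
  inv K * (fromℕ (suc r) * Y)   ≡⟨ *-assoc (inv K) (fromℕ (suc r)) Y ⟨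
  inv K * fromℕ (suc r) * Y     ≡⟨ cong (_* Y) (*-comm (inv K) (fromℕ (suc r))) ⟩
  fromℕ (suc r) * inv K * Y     ∎
  where
  K = suc (r ℕ.+ n)
  Y = x ^ suc n - (x - 1ℚ) * 𝒮 r n x

𝒮-suc-degree-same-rank : ∀ r n x →
  𝒮 r (suc n) x ≡ (fromℕ r * inv (suc (r ℕ.+ n))) * x ^ suc n
                  + (fromℕ (suc n) * inv (suc (r ℕ.+ n))) * ((x - 1ℚ) * 𝒮 r n x)
𝒮-suc-degree-same-rank r n x = begin
  𝒮 r (suc n) x
    ≡⟨ 𝒮-suc-degree r n x ⟩
  x ^ suc n - (fromℕ (suc n) * inv (suc r)) * 𝒮 (suc r) n x
    ≡⟨ cong (λ s → x ^ suc n - (fromℕ (suc n) * inv (suc r)) * s) (𝒮-suc-rank r n x) ⟩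
  x ^ suc n - (fromℕ (suc n) * inv (suc r))
              * ((fromℕ (suc r) * inv (suc (r ℕ.+ n))) * (x ^ suc n - (x - 1ℚ) * 𝒮 r n x))
    ≡⟨ same-rank (fromℕ r) (fromℕ (suc r)) (fromℕ (suc n)) (inv (suc r)) (inv (suc (r ℕ.+ n)))
                 (x ^ suc n) x (𝒮 r n x) (fromℕ-[1+m+n] r n)
                 (inv-inverseˡ (suc (r ℕ.+ n)) (s≤s z≤n)) (inv-inverseˡ (suc r) (s≤s z≤n)) ⟩
  (fromℕ r * inv (suc (r ℕ.+ n))) * x ^ suc n
    + (fromℕ (suc n) * inv (suc (r ℕ.+ n))) * ((x - 1ℚ) * 𝒮 r n x) ∎
  where
  same-rank : ∀ ρ R M r⁻ K⁻ X x S {K} → K ≡ ρ + M → K⁻ * K ≡ 1ℚ → r⁻ * R ≡ 1ℚ →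
              X - (M * r⁻) * ((R * K⁻) * (X - (x - 1ℚ) * S))
                ≡ (ρ * K⁻) * X + (M * K⁻) * ((x - 1ℚ) * S)
  same-rank ρ R M r⁻ K⁻ X x S refl K⁻K≡1 r⁻R≡1 = begin
    X - (M * r⁻) * ((R * K⁻) * (X - (x - 1ℚ) * S))
      ≡⟨ solve (R ∷ M ∷ r⁻ ∷ K⁻ ∷ X ∷ x ∷ S ∷ []) ℚ-ring ⟩
    X - M * K⁻ * (r⁻ * R) * (X - (x - 1ℚ) * S)
      ≡⟨ cong (λ q → X - M * K⁻ * q * (X - (x - 1ℚ) * S)) r⁻R≡1 ⟩
    X - M * K⁻ * 1ℚ * (X - (x - 1ℚ) * S)
      ≡⟨ solve (M ∷ K⁻ ∷ X ∷ x ∷ S ∷ []) ℚ-ring ⟩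
    1ℚ * X - M * K⁻ * (X - (x - 1ℚ) * S)
      ≡⟨ cong (λ q → q * X - M * K⁻ * (X - (x - 1ℚ) * S)) K⁻K≡1 ⟨
    (K⁻ * (ρ + M)) * X - M * K⁻ * (X - (x - 1ℚ) * S)
      ≡⟨ solve (ρ ∷ M ∷ K⁻ ∷ X ∷ x ∷ S ∷ []) ℚ-ring ⟩
    (ρ * K⁻) * X + (M * K⁻) * ((x - 1ℚ) * S) ∎

proposition2p6 : (r n : ℕ) → 1 ≤ r → 1 ≤ n → (x : ℚ) →
    (𝒮 r n x ≡ (x - 1ℚ) * 𝒮 r (n ∸ 1) x + ((+ r) / suc r) * 𝒮 (suc r) (n ∸ 1) x)
  × (𝒮 r n x ≡ (x ^ n) - ((+ n) / suc r) * 𝒮 (suc r) (n ∸ 1) x)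
  × (𝒮 (suc r) n x ≡ ((+ suc r) / suc (r ℕ.+ n)) * ((x ^ suc n) - (x - 1ℚ) * 𝒮 r n x))
  × (𝒮 r (suc n) x ≡ ((+ r) / suc (r ℕ.+ n)) * (x ^ suc n)
                      + ((+ suc n) / suc (r ℕ.+ n)) * ((x - 1ℚ) * 𝒮 r n x))
proposition2p6 r (suc m) _ _ x =
    trans (𝒮-suc-degree-three-term r m x)
          (cong (λ c → (x - 1ℚ) * 𝒮 r m x + c * 𝒮 (suc r) m x) (sym (+m/[1+n]≡m*inv[1+n] r r)))
  , trans (𝒮-suc-degree r m x)
          (cong (λ c → x ^ suc m - c * 𝒮 (suc r) m x) (sym (+m/[1+n]≡m*inv[1+n] (suc m) r)))
  , trans (𝒮-suc-rank r n x)
          (cong (_* (x ^ suc n - (x - 1ℚ) * 𝒮 r n x)) (sym (+m/[1+n]≡m*inv[1+n] (suc r) (r ℕ.+ n))))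
  , trans (𝒮-suc-degree-same-rank r n x)
          (cong₂ (λ a b → a * x ^ suc n + b * ((x - 1ℚ) * 𝒮 r n x))
                 (sym (+m/[1+n]≡m*inv[1+n] r (r ℕ.+ n))) (sym (+m/[1+n]≡m*inv[1+n] (suc n) (r ℕ.+ n))))
  where n = suc m
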